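{- Let $\mathcal I$ be an interpretation, let $U,R$ be role names, and let $$D:=\exists(U\circ R).\top\;\sqcap\;(\leq 1\,(U\circ R)\circ(U\circ R)^-)\;\sqcap\;\neg\exists R^-.\top\;\sqcap\;\neg\exists U^-.\top\;\sqcap\;\forall U.\neg\exists R^-.\top ,$$ $$D':=D\sqcap\forall U.\forall R.\forall R^-.\exists U^-.\top\sqcap\neg\exists R.\top .$$ Let $s\in D'^{\mathcal I}$. Then $s$ has at least one $(U\circ R\circ R^-)$-successor. Moreover, every $y$ with $(s,y)\in(U\circ R\circ R^-)^{\mathcal I}$ satisfies $(s,y)\in U^{\mathcal I}$, and $s$ is the unique $U$-predecessor of $y$, i.e. $(s'',y)\in U^{\mathcal I}$ implies $s''=s$.
   Context: Standard description-logic semantics: $R^-$ denotes the inverse relation and $\circ$ denotes relational composition. $\exists S.E$ denotes the elements having some $S$-successor in $E$, and $\forall S.E$ the elements all of whose $S$-successors lie in $E$. $(\leq n\,S)$ denotes the elements with at most $n$ distinct $S$-successors. $\top^{\mathcal I}=\Delta^{\mathcal I}$. -}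

module Defs where

open import Level using (Level; suc; _⊔_) renaming (zero to lzero)
open import Data.Nat using (ℕ)
import Data.Nat as N
open import Data.Fin using (Fin)
open import Data.Product using (Σ; ∃; _×_; _,_)
open import Data.Empty using (⊥)
open import Data.Unit using (⊤)
open import Relation.Nullary using (¬_)
open import Relation.Binary.PropositionalEquality using (_≡_; _≢_)

record Interpretation (NR : Set) : Set₁ where
  field
    Δ    : Set
    elem : Δ            -- the domain is non-empty
    role : NR → Δ → Δ → Set

Rel : Set → Set₁
Rel Δ = Δ → Δ → Set

Concept : Set → Set₁
Concept Δ = Δ → Set

module _ {Δ : Set} where

  _⁻ : Rel Δ → Rel Δ
  (S ⁻) x y = S y x

  _⊚_ : Rel Δ → Rel Δ → Rel Δ
  (S ⊚ T) x z = Σ Δ λ y → S x y × T y z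

  infixl 7 _⊚_
  infix 8 _⁻

  ⊤ᶜ : Concept Δ
  ⊤ᶜ _ = ⊤

  ¬ᶜ_ : Concept Δ → Concept Δ
  (¬ᶜ C) x = ¬ C x

  _⊓_ : Concept Δ → Concept Δ → Concept Δ
  (C ⊓ E) x = C x × E x

  infixr 6 _⊓_

  ∃ᶜ : Rel Δ → Concept Δ → Concept Δ
  ∃ᶜ S E x = Σ Δ λ y → S x y × E y

  ∀ᶜ : Rel Δ → Concept Δ → Concept Δ
  ∀ᶜ S E x = ∀ y → S x y → E y

  -- (≤ n S): x has at most n distinct S-successors, i.e. among any
  -- n+1 S-successors of x, two (at different positions) coincide.
  atMost : ℕ → Rel Δ → Concept Δ
  atMost n S x = (f : Fin (N.suc n) → Δ) → (∀ i → S x (f i)) →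
                 Σ (Fin (N.suc n)) λ i → Σ (Fin (N.suc n)) λ j → i ≢ j × f i ≡ f j

module _ {NR : Set} (I : Interpretation NR) (U R : NR) where
  open Interpretation I

  Uᴵ Rᴵ : Rel Δ
  Uᴵ = role U
  Rᴵ = role R

  D : Concept Δ
  D = ∃ᶜ (Uᴵ ⊚ Rᴵ) ⊤ᶜ
    ⊓ atMost 1 ((Uᴵ ⊚ Rᴵ) ⊚ ((Uᴵ ⊚ Rᴵ) ⁻))
    ⊓ (¬ᶜ ∃ᶜ (Rᴵ ⁻) ⊤ᶜ)
    ⊓ (¬ᶜ ∃ᶜ (Uᴵ ⁻) ⊤ᶜ)
    ⊓ ∀ᶜ Uᴵ (¬ᶜ ∃ᶜ (Rᴵ ⁻) ⊤ᶜ)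

  D′ : Concept Δ
  D′ = D
     ⊓ ∀ᶜ Uᴵ (∀ᶜ Rᴵ (∀ᶜ (Rᴵ ⁻) (∃ᶜ (Uᴵ ⁻) ⊤ᶜ)))
     ⊓ (¬ᶜ ∃ᶜ Rᴵ ⊤ᶜ)

-- A (U ∘ R ∘ R⁻)-path s → a → b ← y and a U-edge s″ → y yield two
-- ((U ∘ R) ∘ (U ∘ R)⁻)-successors of s through b, namely s itself and s″, so the
-- restriction (≤ 1 (U ∘ R) ∘ (U ∘ R)⁻) forces s″ = s. The axiom ∀U.∀R.∀R⁻.∃U⁻.⊤
-- supplies a U-predecessor of y, which must therefore be s.
module Submission where

open import Defs
open import Data.Fin using (Fin; zero; suc)
open import Data.Product using (Σ; _×_; _,_)
open import Relation.Nullary using (contradiction)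
open import Relation.Binary.PropositionalEquality using (_≡_; refl; sym; subst)

module _ {Δ : Set} where

  atMost1⇒≡ : ∀ {S : Rel Δ} {x a b} → atMost 1 S x → S x a → S x b → a ≡ b
  atMost1⇒≡ {S} {x} {a} {b} atMost1 Sxa Sxb with atMost1 pair Spair
    where
    pair : Fin 2 → Δ
    pair zero    = a
    pair (suc _) = b

    Spair : ∀ i → S x (pair i)
    Spair zero    = Sxa
    Spair (suc _) = Sxb
  ... | zero        , zero        , i≢j , _   = contradiction refl i≢j
  ... | zero        , suc zero    , _   , a≡b = a≡b
  ... | suc zero    , zero        , _   , b≡a = sym b≡a
  ... | suc zero    , suc zero    , i≢j , _   = contradiction refl i≢j

  ∃⊚⇒∃⊚⊚⁻ : ∀ {S T : Rel Δ} {x} → ∃ᶜ (S ⊚ T) ⊤ᶜ x → Σ Δ λ y → (S ⊚ T ⊚ T ⁻) x y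
  ∃⊚⇒∃⊚⊚⁻ (b , (a , Sxa , Tab) , _) = a , b , (a , Sxa , Tab) , Tab

  ∀ᶜ³⇒∀ᶜ⊚⊚ : ∀ {S T V : Rel Δ} {C : Concept Δ} {x} →
             ∀ᶜ S (∀ᶜ T (∀ᶜ V C)) x → ∀ᶜ (S ⊚ T ⊚ V) C x
  ∀ᶜ³⇒∀ᶜ⊚⊚ ∀STV _ (b , (a , Sxa , Tab) , Vby) = ∀STV a Sxa b Tab _ Vby

  ⊚⊚⁻-predecessor-unique : ∀ {S T : Rel Δ} {x y x″} →
    atMost 1 ((S ⊚ T) ⊚ (S ⊚ T) ⁻) x →
    (S ⊚ T ⊚ T ⁻) x y → S x″ y → x″ ≡ x
  ⊚⊚⁻-predecessor-unique {S} {T} atMost1 (b , STxb , Tyb) Sx″y =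
    sym (atMost1⇒≡ {S = (S ⊚ T) ⊚ (S ⊚ T) ⁻} atMost1
                   (b , STxb , STxb) (b , STxb , (_ , Sx″y , Tyb)))

corollary4 : {NR : Set} (I : Interpretation NR) (U R : NR) →
    let open Interpretation I in
    (s : Δ) → D′ I U R s →
      (Σ Δ λ y → (Uᴵ I U R ⊚ Rᴵ I U R ⊚ (Rᴵ I U R ⁻)) s y)
      × (∀ y → (Uᴵ I U R ⊚ Rᴵ I U R ⊚ (Rᴵ I U R ⁻)) s y →
           Uᴵ I U R s y × (∀ s″ → Uᴵ I U R s″ y → s″ ≡ s))
corollary4 I U R s ((∃UR , atMost1 , _) , ∀U∀R∀R⁻∃U⁻ , _) =
  ∃⊚⇒∃⊚⊚⁻ {S = Uᴵ I U R} ∃UR , λ y path →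
    let unique : ∀ s″ → Uᴵ I U R s″ y → s″ ≡ s
        unique s″ = ⊚⊚⁻-predecessor-unique {S = Uᴵ I U R} {T = Rᴵ I U R} atMost1 path
        (s′ , Us′y , _) = ∀ᶜ³⇒∀ᶜ⊚⊚ {S = Uᴵ I U R} ∀U∀R∀R⁻∃U⁻ y path
    in subst (λ z → Uᴵ I U R z y) (unique s′ Us′y) Us′y , unique
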